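{- Let $u\le w$ in $S_n$, let $\mathbf{w}=s_{i_1}\cdots s_{i_m}$ be a reduced word for $w$, and let $J$ be the set of positions of the positive distinguished subexpression (PDS) for $u$ in $\mathbf{w}$. Suppose $\mathbf{w}'$ is obtained from $\mathbf{w}$ by a braid move at positions $p,p+1,p+2$ (so $i_p=i_{p+2}$, $|i_p-i_{p+1}|=1$, and $\mathbf{w}'$ has letters $s_{i_{p+1}}s_{i_p}s_{i_{p+1}}$ at these positions and agrees with $\mathbf{w}$ elsewhere), and let $J'$ be the set of positions of the PDS for $u$ in $\mathbf{w}'$. Write $\epsilon=(\epsilon_1,\epsilon_2,\epsilon_3)$ with $\epsilon_i=1$ if $p+i-1\in J$ and $0$ otherwise, and similarly $\epsilon'$ for $J'$. Then $J'$ agrees with $J$ outside $\{p,p+1,p+2\}$, and $\epsilon'$ is obtained from $\epsilon$ by the rule $(0,1,1)\mapsto(1,1,0)$, $(1,1,0)\mapsto(0,1,1)$, $(1,1,1)\mapsto(1,1,1)$, $(0,0,1)\mapsto(0,1,0)$, $(0,1,0)\mapsto(0,0,1)$, $(0,0,0)\mapsto(0,0,0)$.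
   Context: For a reduced word $\mathbf{w}=s_{i_1}\cdots s_{i_m}$ and $J\subseteq[m]$, let $u_{(j)}$ be the ordered product of the letters $s_{i_q}$ with $q\in J$, $q\le j$ ($u_{(0)}=1$). $J$ is a positive distinguished subexpression for $u=u_{(m)}$ if $u_{(j)}\le u_{(j-1)}s_{i_j}$ and $u_{(j-1)}<u_{(j-1)}s_{i_j}$ for all $j$ (Bruhat order); for $u\le w$ it exists and is unique. -}

module Defs where

open import Data.Nat using (ℕ; zero; suc; _+_; _∸_; _<_; _≤_; _<ᵇ_)
open import Data.Bool using (Bool; true; false; if_then_else_)
open import Data.Fin using (Fin; toℕ)
open import Data.Vec using (Vec; []; _∷_; lookup; allFin; _[_]≔_)
open import Data.List using (List; []; _∷_; foldl)
open import Data.Product using (_×_)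
open import Data.Unit using (⊤)
open import Data.Empty using (⊥)
open import Relation.Nullary using (¬_)
open import Relation.Binary.PropositionalEquality using (_≡_)

-- Elements of S_n in one-line notation: v = (v(0), …, v(n-1)), 0-based values.
Perm : ℕ → Set
Perm n = Vec (Fin n) n

idP : (n : ℕ) → Perm n
idP n = allFin n

-- number of inversions = Coxeter length ℓ in S_n
countBelow : ∀ {n k} → Fin n → Vec (Fin n) k → ℕ
countBelow x [] = 0
countBelow x (y ∷ ys) = (if toℕ y <ᵇ toℕ x then 1 else 0) + countBelow x ys

len : ∀ {n k} → Vec (Fin n) k → ℕ
len [] = 0
len (x ∷ xs) = countBelow x xs + len xs

-- right multiplication v·t by the transposition t = (a b): swap entries at positions a, b
swapPos : ∀ {n} → Fin n → Fin n → Perm n → Perm n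
swapPos a b v = (v [ a ]≔ lookup v b) [ b ]≔ lookup v a

-- Bruhat order: reflexive-transitive closure of  v < v·t  for transpositions t with ℓ(v·t) > ℓ(v)
data _≤B_ {n : ℕ} : Perm n → Perm n → Set where
  ≤B-refl : ∀ {u} → u ≤B u
  ≤B-step : ∀ {u v} → u ≤B v → (a b : Fin n) → len v < len (swapPos a b v) → u ≤B swapPos a b v

_<B_ : ∀ {n} → Perm n → Perm n → Set
u <B v = (u ≤B v) × ¬ (u ≡ v)

swapAdj : ∀ {A : Set} {n} → ℕ → Vec A n → Vec A n
swapAdj zero (x ∷ y ∷ xs) = y ∷ x ∷ xs
swapAdj (suc k) (x ∷ xs) = x ∷ swapAdj k xs
swapAdj _ xs = xs

-- right multiplication v·s_i by the simple transposition s_i = (i, i+1), 1 ≤ i ≤ n-1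
_·s_ : ∀ {n} → Perm n → ℕ → Perm n
v ·s i = swapAdj (i ∸ 1) v

prod : (n : ℕ) → List ℕ → Perm n
prod n ws = foldl _·s_ (idP n) ws

data InRange (n : ℕ) : List ℕ → Set where
  []  : InRange n []
  _∷_ : ∀ {i ws} → (1 ≤ i × suc i ≤ n) → InRange n ws → InRange n (i ∷ ws)

wlen : List ℕ → ℕ
wlen [] = 0
wlen (_ ∷ ws) = suc (wlen ws)

Reduced : (n : ℕ) → List ℕ → Set
Reduced n ws = InRange n ws × wlen ws ≡ len (prod n ws)

-- PDS conditions along the word, starting from the current partial product cur = u_(j-1);
-- the mask J is a list of booleans (true at position q iff q ∈ J); the last argument is u.
PDSfrom : ∀ {n} → Perm n → List ℕ → List Bool → Perm n → Set
PDSfrom cur [] [] u = cur ≡ u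
PDSfrom cur (i ∷ ws) (b ∷ bs) u =
  let next = if b then cur ·s i else cur in
  (next ≤B (cur ·s i)) × (cur <B (cur ·s i)) × PDSfrom next ws bs u
PDSfrom cur [] (_ ∷ _) u = ⊥
PDSfrom cur (_ ∷ _) [] u = ⊥

IsPDS : (n : ℕ) → List ℕ → List Bool → Perm n → Set
IsPDS n ws J u = PDSfrom (idP n) ws J u

data AdjLetters : ℕ → ℕ → Set where
  up   : ∀ {a} → AdjLetters a (suc a)
  down : ∀ {a} → AdjLetters (suc a) a

data Rule : Bool → Bool → Bool → Bool → Bool → Bool → Set where
  r011 : Rule false true  true   true  true  false
  r110 : Rule true  true  false  false true  true
  r111 : Rule true  true  true   true  true  true
  r001 : Rule false false true   false true  false
  r010 : Rule false true  false  false false true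
  r000 : Rule false false false  false false false

module Submission where

-- A mask J is a *positive walk* along a word if every letter s_i is an ascent of the current
-- partial product u_(j-1) (its entries at positions i-1, i increase), the letter being
-- applied exactly when it lies in J.  Every PDS is a positive walk, because a Bruhat ascent
-- by an adjacent transposition lengthens the permutation, and only increasing pairs do so.
--
-- Two facts about positive walks, valid for vectors over any strict order, do the work:
--   * uniqueness: a positive walk is determined by its end point, since at each step the
--     letter is applied iff the current product has a descent there (read from the right);
--   * the braid move: a positive walk through s_a s_b s_a with |a - b| = 1 and mask ε can be
--     replaced by one through s_b s_a s_b with the same end points and mask ε', ε ↦ ε' being
--     the rule.  Prepending a fixed entry reduces it to the first three positions, where it
--     is a finite check on the order of three entries.
-- The theorem follows: cut the walk of J at the block, apply the braid move to the block,
-- glue, and conclude by uniqueness that the given PDS J' is the glued mask.  (Reducedness of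
-- the word and u ≤ w only guarantee that the PDS exist; both are given here.)

open import Defs
open import Data.Nat using (ℕ)
open import Data.Bool using (Bool)
open import Data.List using (List; _∷_; _++_; length)
open import Data.Product using (Σ; ∃; _×_; _,_)
open import Relation.Binary.PropositionalEquality using (_≡_)

open import Data.Bool using (true; false; T; if_then_else_)
open import Data.Empty using (⊥; ⊥-elim)
open import Data.Fin using (Fin; toℕ)
open import Data.List using ([]; map)
open import Data.Nat using (zero; suc; pred; _+_; _∸_; _<_; _≤_; _<ᵇ_)
open import Data.Nat.Properties
  using (<ᵇ⇒<; <⇒<ᵇ; <-asym; <-trans; <-irrefl; <⇒≱; +-cancelˡ-<; +-assoc; m≤n+m; +-commutativeSemigroup; module ≤-Reasoning)
open import Algebra.Properties.CommutativeSemigroup +-commutativeSemigroup using (x∙yz≈y∙xz)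
open import Data.Product using (proj₂)
open import Data.Sum using (_⊎_; inj₁; inj₂)
open import Data.Unit using (tt)
open import Data.Vec using (Vec; []; _∷_)
open import Relation.Binary.PropositionalEquality using (refl; sym; trans; cong; subst; module ≡-Reasoning)

swapAdj-involutive : ∀ {A : Set} {m} k (v : Vec A m) → swapAdj k (swapAdj k v) ≡ v
swapAdj-involutive zero [] = refl
swapAdj-involutive zero (x ∷ []) = refl
swapAdj-involutive zero (x ∷ y ∷ v) = refl
swapAdj-involutive (suc k) [] = refl
swapAdj-involutive (suc k) (x ∷ v) = cong (x ∷_) (swapAdj-involutive k v)

module PositiveWalks {A : Set} (lt : A → A → Bool)
  (lt-asym : ∀ {x y} → T (lt x y) → T (lt y x) → ⊥)
  (lt-trans : ∀ {x y z} → T (lt x y) → T (lt y z) → T (lt x z)) where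

  ascAt : ∀ {m} → ℕ → Vec A m → Bool
  ascAt zero (x ∷ y ∷ _) = lt x y
  ascAt (suc k) (_ ∷ v) = ascAt k v
  ascAt _ _ = false

  ascAt-swap-asym : ∀ {m} k (v : Vec A m) → T (ascAt k v) → T (ascAt k (swapAdj k v)) → ⊥
  ascAt-swap-asym zero (x ∷ y ∷ v) p q = lt-asym p q
  ascAt-swap-asym (suc k) (x ∷ v) p q = ascAt-swap-asym k v p q

  act : ∀ {m} → Bool → ℕ → Vec A m → Vec A m
  act b i v = if b then swapAdj (i ∸ 1) v else v

  Positive : ∀ {m} → Vec A m → List ℕ → List Bool → Vec A m → Set
  Positive cur [] [] u = cur ≡ u
  Positive cur (i ∷ ws) (b ∷ bs) u = T (ascAt (i ∸ 1) cur) × Positive (act b i cur) ws bs u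
  Positive cur [] (_ ∷ _) u = ⊥
  Positive cur (_ ∷ _) [] u = ⊥

  -- Uniqueness: along a fixed word, a positive walk is determined by its end point.  Read
  -- from the right, a letter was applied iff the product after it has a descent there.
  positive-unique : ∀ {m} {c₁ c₂ : Vec A m} ws {J₁ J₂ u} →
    Positive c₁ ws J₁ u → Positive c₂ ws J₂ u → c₁ ≡ c₂ × J₁ ≡ J₂
  positive-unique [] {[]} {[]} p q = trans p (sym q) , refl
  positive-unique {c₁ = c₁} {c₂} (i ∷ ws) {b₁ ∷ J₁} {b₂ ∷ J₂} (a₁ , w₁) (a₂ , w₂)
    with positive-unique ws w₁ w₂
  ... | next≡ , refl with b₁ | b₂
  ... | false | false = next≡ , refl
  ... | true | true = swapAdj-injective next≡ , refl
    where
    open ≡-Reasoning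
    swapAdj-injective : swapAdj (i ∸ 1) c₁ ≡ swapAdj (i ∸ 1) c₂ → c₁ ≡ c₂
    swapAdj-injective eq = begin
      c₁                                     ≡⟨ sym (swapAdj-involutive (i ∸ 1) c₁) ⟩
      swapAdj (i ∸ 1) (swapAdj (i ∸ 1) c₁)  ≡⟨ cong (swapAdj (i ∸ 1)) eq ⟩
      swapAdj (i ∸ 1) (swapAdj (i ∸ 1) c₂)  ≡⟨ swapAdj-involutive (i ∸ 1) c₂ ⟩
      c₂                                     ∎
  ... | true | false =
    ⊥-elim (ascAt-swap-asym (i ∸ 1) c₁ a₁ (subst (λ v → T (ascAt (i ∸ 1) v)) (sym next≡) a₂))
  ... | false | true =
    ⊥-elim (ascAt-swap-asym (i ∸ 1) c₂ a₂ (subst (λ v → T (ascAt (i ∸ 1) v)) next≡ a₁))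

  positive-++ : ∀ {m} {c mid u : Vec A m} xs {ys J₁ J₂} →
    Positive c xs J₁ mid → Positive mid ys J₂ u → Positive c (xs ++ ys) (J₁ ++ J₂) u
  positive-++ [] {J₁ = []} refl w = w
  positive-++ (i ∷ xs) {J₁ = b ∷ J₁} (a , w) w′ = a , positive-++ xs w w′

  positive-split : ∀ {m} {c u : Vec A m} xs {ys} J₁ {J₂} → length J₁ ≡ length xs →
    Positive c (xs ++ ys) (J₁ ++ J₂) u → ∃ λ mid → Positive c xs J₁ mid × Positive mid ys J₂ u
  positive-split {c = c} [] [] _ w = c , refl , w
  positive-split (i ∷ xs) (b ∷ J₁) len≡ (a , w) with positive-split xs J₁ (cong pred len≡) w
  ... | mid , w₁ , w₂ = mid , (a , w₁) , w₂

  prepend : ∀ {m} h {x y : Vec A m} ws J →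
    Positive x (map suc ws) J y → Positive (h ∷ x) (map suc (map suc ws)) J (h ∷ y)
  prepend h [] [] refl = refl
  prepend h (i ∷ ws) (true ∷ J) (a , w) = a , prepend h ws J w
  prepend h (i ∷ ws) (false ∷ J) (a , w) = a , prepend h ws J w

  strip : ∀ {m} h {x : Vec A m} {z} ws J → Positive (h ∷ x) (map suc (map suc ws)) J z →
    ∃ λ y → z ≡ h ∷ y × Positive x (map suc ws) J y
  strip h {x} [] [] refl = x , refl , refl
  strip h (i ∷ ws) (true ∷ J) (a , w) with strip h ws J w
  ... | y , refl , w′ = y , refl , a , w′
  strip h (i ∷ ws) (false ∷ J) (a , w) with strip h ws J w
  ... | y , refl , w′ = y , refl , a , w′

  BraidPartner : ∀ {m} → Bool → Bool → Bool → Vec A m → List ℕ → Vec A m → Set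
  BraidPartner e1 e2 e3 x ws y =
    ∃ λ f1 → ∃ λ f2 → ∃ λ f3 → Rule e1 e2 e3 f1 f2 f3 × Positive x ws (f1 ∷ f2 ∷ f3 ∷ []) y

  -- The braid move s_{k+1} s_{k+2} s_{k+1} ↦ s_{k+2} s_{k+1} s_{k+2}, reduced to k = 0 by
  -- strip/prepend.  There the ascents force p < q < r in the start window (p, q, r), the mask
  -- (1,0,·) is impossible, and each of the six remaining masks has its partner by the rule.
  braid-up : ∀ {m} k {x y : Vec A m} e1 e2 e3 →
    Positive x (suc k ∷ suc (suc k) ∷ suc k ∷ []) (e1 ∷ e2 ∷ e3 ∷ []) y →
    BraidPartner e1 e2 e3 x (suc (suc k) ∷ suc k ∷ suc (suc k) ∷ []) y
  braid-up zero {[]} _ _ _ (() , _)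
  braid-up zero {_ ∷ []} _ _ _ (() , _)
  braid-up zero {_ ∷ _ ∷ []} false _ _ (_ , () , _)
  braid-up zero {_ ∷ _ ∷ []} true _ _ (_ , () , _)
  braid-up zero {p ∷ q ∷ r ∷ _} false false false (pq , qr , _ , refl) =
    _ , _ , _ , r000 , qr , pq , qr , refl
  braid-up zero {p ∷ q ∷ r ∷ _} false false true (pq , qr , _ , refl) =
    _ , _ , _ , r001 , qr , pq , lt-trans pq qr , refl
  braid-up zero {p ∷ q ∷ r ∷ _} false true false (pq , qr , _ , refl) =
    _ , _ , _ , r010 , qr , pq , qr , refl
  braid-up zero {p ∷ q ∷ r ∷ _} false true true (pq , qr , pr , refl) =
    _ , _ , _ , r011 , qr , pr , pq , refl
  braid-up zero {p ∷ q ∷ r ∷ _} true false _ (pq , _ , qp , _) = ⊥-elim (lt-asym pq qp)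
  braid-up zero {p ∷ q ∷ r ∷ _} true true false (pq , pr , qr , refl) =
    _ , _ , _ , r110 , qr , pq , pr , refl
  braid-up zero {p ∷ q ∷ r ∷ _} true true true (pq , pr , qr , refl) =
    _ , _ , _ , r111 , qr , pr , pq , refl
  braid-up (suc k) {[]} _ _ _ (() , _)
  braid-up (suc k) {h ∷ x} e1 e2 e3 w with strip h (k ∷ suc k ∷ k ∷ []) (e1 ∷ e2 ∷ e3 ∷ []) w
  ... | y , refl , w′ with braid-up k e1 e2 e3 w′
  ... | f1 , f2 , f3 , rule , v =
    f1 , f2 , f3 , rule , prepend h (suc k ∷ k ∷ suc k ∷ []) (f1 ∷ f2 ∷ f3 ∷ []) v

  -- The braid move s_{k+2} s_{k+1} s_{k+2} ↦ s_{k+1} s_{k+2} s_{k+1}, by the same analysis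
  -- (here the ascents force q < r and p < q, and the mask (1,0,·) is impossible).
  braid-down : ∀ {m} k {x y : Vec A m} e1 e2 e3 →
    Positive x (suc (suc k) ∷ suc k ∷ suc (suc k) ∷ []) (e1 ∷ e2 ∷ e3 ∷ []) y →
    BraidPartner e1 e2 e3 x (suc k ∷ suc (suc k) ∷ suc k ∷ []) y
  braid-down zero {[]} _ _ _ (() , _)
  braid-down zero {_ ∷ []} _ _ _ (() , _)
  braid-down zero {_ ∷ _ ∷ []} _ _ _ (() , _)
  braid-down zero {p ∷ q ∷ r ∷ _} false false false (qr , pq , _ , refl) =
    _ , _ , _ , r000 , pq , qr , pq , refl
  braid-down zero {p ∷ q ∷ r ∷ _} false false true (qr , pq , _ , refl) =
    _ , _ , _ , r001 , pq , qr , lt-trans pq qr , refl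
  braid-down zero {p ∷ q ∷ r ∷ _} false true false (qr , pq , _ , refl) =
    _ , _ , _ , r010 , pq , qr , pq , refl
  braid-down zero {p ∷ q ∷ r ∷ _} false true true (qr , pq , pr , refl) =
    _ , _ , _ , r011 , pq , pr , qr , refl
  braid-down zero {p ∷ q ∷ r ∷ _} true false _ (qr , _ , rq , _) = ⊥-elim (lt-asym qr rq)
  braid-down zero {p ∷ q ∷ r ∷ _} true true false (qr , pr , pq , refl) =
    _ , _ , _ , r110 , pq , qr , pr , refl
  braid-down zero {p ∷ q ∷ r ∷ _} true true true (qr , pr , pq , refl) =
    _ , _ , _ , r111 , pq , pr , qr , refl
  braid-down (suc k) {[]} _ _ _ (() , _)
  braid-down (suc k) {h ∷ x} e1 e2 e3 w with strip h (suc k ∷ k ∷ suc k ∷ []) (e1 ∷ e2 ∷ e3 ∷ []) w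
  ... | y , refl , w′ with braid-down k e1 e2 e3 w′
  ... | f1 , f2 , f3 , rule , v =
    f1 , f2 , f3 , rule , prepend h (k ∷ suc k ∷ k ∷ []) (f1 ∷ f2 ∷ f3 ∷ []) v

  braid : ∀ {m} {a b} {x y : Vec A m} → AdjLetters a b → 1 ≤ a → 1 ≤ b → ∀ e1 e2 e3 →
    Positive x (a ∷ b ∷ a ∷ []) (e1 ∷ e2 ∷ e3 ∷ []) y → BraidPartner e1 e2 e3 x (b ∷ a ∷ b ∷ []) y
  braid (up {zero}) () _
  braid (up {suc k}) _ _ = braid-up k
  braid (down {zero}) _ ()
  braid (down {suc k}) _ _ = braid-down k

_<ᶠ_ : ∀ {n} → Fin n → Fin n → Bool
x <ᶠ y = toℕ x <ᵇ toℕ y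

<ᶠ-asym : ∀ {n} {x y : Fin n} → T (x <ᶠ y) → T (y <ᶠ x) → ⊥
<ᶠ-asym {x = x} {y} p q = <-asym (<ᵇ⇒< (toℕ x) (toℕ y) p) (<ᵇ⇒< (toℕ y) (toℕ x) q)

<ᶠ-trans : ∀ {n} {x y z : Fin n} → T (x <ᶠ y) → T (y <ᶠ z) → T (x <ᶠ z)
<ᶠ-trans {x = x} {y} {z} p q = <⇒<ᵇ (<-trans (<ᵇ⇒< (toℕ x) (toℕ y) p) (<ᵇ⇒< (toℕ y) (toℕ z) q))

module FinWalks {n : ℕ} = PositiveWalks {Fin n} _<ᶠ_
  (λ {x} {y} → <ᶠ-asym {x = x} {y}) (λ {x} {y} {z} → <ᶠ-trans {x = x} {y} {z})
open FinWalks

ind : Bool → ℕ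
ind b = if b then 1 else 0

countBelow-swapAdj : ∀ {n m} (x : Fin n) k (ys : Vec (Fin n) m) →
  countBelow x (swapAdj k ys) ≡ countBelow x ys
countBelow-swapAdj x zero [] = refl
countBelow-swapAdj x zero (y ∷ []) = refl
countBelow-swapAdj x zero (y₁ ∷ y₂ ∷ ys) = x∙yz≈y∙xz (ind (y₂ <ᶠ x)) (ind (y₁ <ᶠ x)) (countBelow x ys)
countBelow-swapAdj x (suc k) [] = refl
countBelow-swapAdj x (suc k) (y ∷ ys) = cong (_ +_) (countBelow-swapAdj x k ys)

-- Swapping the front pair (x, y) changes the inversion count from
-- [y < x] + B + (C + L) to [x < y] + C + (B + L); it can only grow if x < y.
front-swap-lengthens⇒increasing : (b c : Bool) (B C L : ℕ) →
  (ind c + B) + (C + L) < (ind b + C) + (B + L) → T b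
front-swap-lengthens⇒increasing true c B C L h = tt
front-swap-lengthens⇒increasing false c B C L h = ⊥-elim (<⇒≱ h swapped≤)
  where
  open ≤-Reasoning
  swapped≤ : C + (B + L) ≤ (ind c + B) + (C + L)
  swapped≤ = begin
    C + (B + L)            ≡⟨ x∙yz≈y∙xz C B L ⟩
    B + (C + L)            ≤⟨ m≤n+m _ (ind c) ⟩
    ind c + (B + (C + L))  ≡⟨ sym (+-assoc (ind c) B (C + L)) ⟩
    (ind c + B) + (C + L)  ∎

lengthening⇒ascent : ∀ {n m} k (v : Vec (Fin n) m) → len v < len (swapAdj k v) → T (ascAt k v)
lengthening⇒ascent zero [] h = ⊥-elim (<-irrefl refl h)
lengthening⇒ascent zero (x ∷ []) h = ⊥-elim (<-irrefl refl h)
lengthening⇒ascent zero (x ∷ y ∷ v) h =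
  front-swap-lengthens⇒increasing (x <ᶠ y) (y <ᶠ x) (countBelow x v) (countBelow y v) (len v) h
lengthening⇒ascent (suc k) [] h = ⊥-elim (<-irrefl refl h)
lengthening⇒ascent (suc k) (x ∷ v) h =
  lengthening⇒ascent k v (+-cancelˡ-< (countBelow x v) (len v) (len (swapAdj k v)) h′)
  where
  h′ : countBelow x v + len v < countBelow x v + len (swapAdj k v)
  h′ = subst (λ c → countBelow x v + len v < c + len (swapAdj k v)) (countBelow-swapAdj x k v) h

≤B⇒≡⊎len< : ∀ {n} {u v : Perm n} → u ≤B v → u ≡ v ⊎ len u < len v
≤B⇒≡⊎len< ≤B-refl = inj₁ refl
≤B⇒≡⊎len< (≤B-step u≤v a b longer) with ≤B⇒≡⊎len< u≤v
... | inj₁ refl = inj₂ longer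
... | inj₂ shorter = inj₂ (<-trans shorter longer)

<B⇒len< : ∀ {n} {u v : Perm n} → u <B v → len u < len v
<B⇒len< (u≤v , u≢v) with ≤B⇒≡⊎len< u≤v
... | inj₁ u≡v = ⊥-elim (u≢v u≡v)
... | inj₂ shorter = shorter

-- Every PDS is a positive walk: each of its letters is a Bruhat ascent, hence an ascent.
pds⇒positive : ∀ {n} {cur u : Perm n} ws J → PDSfrom cur ws J u → Positive cur ws J u
pds⇒positive [] [] reached = reached
pds⇒positive {cur = cur} (i ∷ ws) (b ∷ J) (_ , ascent , rest) =
  lengthening⇒ascent (i ∸ 1) cur (<B⇒len< ascent) , pds⇒positive ws J rest

braid-letters-positive : ∀ {n} pre {a b post} → InRange n (pre ++ (a ∷ b ∷ a ∷ post)) → 1 ≤ a × 1 ≤ b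
braid-letters-positive [] ((1≤a , _) ∷ (1≤b , _) ∷ _) = 1≤a , 1≤b
braid-letters-positive (_ ∷ pre) (_ ∷ inRange) = braid-letters-positive pre inRange

proposition5p1 : (n : ℕ) (pre post : List ℕ) (a b : ℕ) → AdjLetters a b →
    Reduced n (pre ++ (a ∷ b ∷ a ∷ post)) →
    (u : Perm n) → u ≤B prod n (pre ++ (a ∷ b ∷ a ∷ post)) →
    (Jpre Jpost : List Bool) (e1 e2 e3 : Bool) →
    length Jpre ≡ length pre → length Jpost ≡ length post →
    IsPDS n (pre ++ (a ∷ b ∷ a ∷ post)) (Jpre ++ (e1 ∷ e2 ∷ e3 ∷ Jpost)) u →
    (J' : List Bool) → IsPDS n (pre ++ (b ∷ a ∷ b ∷ post)) J' u →
    ∃ λ f1 → ∃ λ f2 → ∃ λ f3 →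
    (J' ≡ Jpre ++ (f1 ∷ f2 ∷ f3 ∷ Jpost)) × Rule e1 e2 e3 f1 f2 f3
proposition5p1 n pre post a b adj (inRange , _) u _ Jpre Jpost e1 e2 e3 lenPre _ pds J' pds′
  with positive-split pre Jpre lenPre (pds⇒positive _ _ pds)
... | _ , walkPre , walkRest with positive-split (a ∷ b ∷ a ∷ []) (e1 ∷ e2 ∷ e3 ∷ []) refl walkRest
... | _ , walkBlock , walkPost with braid-letters-positive pre inRange
... | 1≤a , 1≤b with braid adj 1≤a 1≤b e1 e2 e3 walkBlock
... | f1 , f2 , f3 , rule , walkBlock′ = f1 , f2 , f3 , J'≡ , rule
  where
  -- the braid-moved walk, glued back, is a positive walk along the new word; so is J'
  walkMoved : Positive (idP n) (pre ++ (b ∷ a ∷ b ∷ post)) (Jpre ++ (f1 ∷ f2 ∷ f3 ∷ Jpost)) u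
  walkMoved =
    positive-++ pre walkPre (positive-++ (b ∷ a ∷ b ∷ []) {J₁ = f1 ∷ f2 ∷ f3 ∷ []} walkBlock′ walkPost)
  J'≡ : J' ≡ Jpre ++ (f1 ∷ f2 ∷ f3 ∷ Jpost)
  J'≡ = proj₂ (positive-unique (pre ++ (b ∷ a ∷ b ∷ post)) (pds⇒positive _ _ pds′) walkMoved)
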